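{- Let $G(V, E)$ be a graph with $|V| = n$. Suppose for any vertex $ x \in V$ there is another vertex $ u \in V$ such that $V\setminus N(x) \subseteq N(u)$. Then $\mathrm{edim}(G + K_1) = n$. Otherwise, $\mathrm{edim}(G + K_1) = n-1$.
   Context: All graphs are simple, connected and undirected. $N(v)$ denotes the set of vertices adjacent to $v$ (not including $v$). $G + K_1$ is obtained from $G$ by adding one new vertex adjacent to all vertices of $G$. For an edge $e=xy$ and vertex $v$, $d(e,v)=\min\{d(x,v),d(y,v)\}$; $\mathrm{edim}(G)$ is the minimum size of a set $S\subseteq V$ such that any two distinct edges have different distance to some vertex of $S$. -}

module Defs where

open import Data.Nat using (ℕ; zero; suc; _≤_; _<_; _⊔_; _⊓_)
open import Data.Bool using (Bool; true; false; _∧_; _∨_; if_then_else_)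
open import Data.Fin using (Fin; zero; suc; toℕ; _≟_)
open import Data.Fin.Subset using (Subset; _∈_; ∣_∣)
open import Data.List using (allFin)
open import Data.Bool.ListAction using (any)
open import Data.Product using (Σ; ∃; _×_; _,_)
open import Data.Sum using (_⊎_)
open import Relation.Nullary using (¬_; ⌊_⌋)
open import Relation.Binary.PropositionalEquality using (_≡_; _≢_)

record Graph (n : ℕ) : Set where
  field
    adj    : Fin n → Fin n → Bool
    sym    : ∀ i j → adj i j ≡ adj j i
    irrefl : ∀ i → adj i i ≡ false
open Graph public

reach : ∀ {n} → Graph n → ℕ → Fin n → Fin n → Bool
reach G zero    u v = ⌊ u ≟ v ⌋
reach {n} G (suc k) u v =
  reach G k u v ∨ any (λ w → adj G u w ∧ reach G k w v) (allFin n)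

Connected : ∀ {n} → Graph n → Set
Connected G = ∀ u v → ∃ λ k → reach G k u v ≡ true

-- least b p : the least k < b with p k ≡ true (and b if there is none).
least : ℕ → (ℕ → Bool) → ℕ
least zero    p = zero
least (suc b) p = if p zero then zero else suc (least b (λ k → p (suc k)))

-- Distance d(u,v): length of a shortest u-v path (= shortest walk).
-- In a connected graph on n vertices it is < n, so the search bound n suffices.
dist : ∀ {n} → Graph n → Fin n → Fin n → ℕ
dist {n} G u v = least n (λ k → reach G k u v)

-- Edges are represented by their endpoints x, y with toℕ x < toℕ y.
IsEdge : ∀ {n} → Graph n → Fin n → Fin n → Set
IsEdge G x y = (toℕ x < toℕ y) × (adj G x y ≡ true)

edgeDist : ∀ {n} → Graph n → Fin n → Fin n → Fin n → ℕ
edgeDist G x y v = dist G x v ⊓ dist G y v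

EdgeResolving : ∀ {n} → Graph n → Subset n → Set
EdgeResolving G S =
  ∀ x y x' y' → IsEdge G x y → IsEdge G x' y' → (x ≢ x' ⊎ y ≢ y') →
  ∃ λ s → s ∈ S × edgeDist G x y s ≢ edgeDist G x' y' s

IsEdim : ∀ {n} → Graph n → ℕ → Set
IsEdim {n} G k =
  (∃ λ (S : Subset n) → EdgeResolving G S × ∣ S ∣ ≡ k) ×
  (∀ (S : Subset n) → EdgeResolving G S → k ≤ ∣ S ∣)

-- G + K₁ : the new vertex is zero, the old vertex i becomes suc i.
joinAdj : ∀ {n} → (Fin n → Fin n → Bool) → Fin (suc n) → Fin (suc n) → Bool
joinAdj a zero    zero    = false
joinAdj a zero    (suc j) = true
joinAdj a (suc i) zero    = true
joinAdj a (suc i) (suc j) = a i j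

joinSym : ∀ {n} (G : Graph n) → ∀ i j → joinAdj (adj G) i j ≡ joinAdj (adj G) j i
joinSym G zero    zero    = _≡_.refl
joinSym G zero    (suc j) = _≡_.refl
joinSym G (suc i) zero    = _≡_.refl
joinSym G (suc i) (suc j) = sym G i j

joinIrrefl : ∀ {n} (G : Graph n) → ∀ i → joinAdj (adj G) i i ≡ false
joinIrrefl G zero    = _≡_.refl
joinIrrefl G (suc i) = irrefl G i

_+K₁ : ∀ {n} → Graph n → Graph (suc n)
G +K₁ = record { adj = joinAdj (adj G) ; sym = joinSym G ; irrefl = joinIrrefl G }

Cond : ∀ {n} → Graph n → Set
Cond {n} G = ∀ (x : Fin n) → ∃ λ (u : Fin n) →
  (u ≢ x) × (∀ (v : Fin n) → adj G x v ≡ false → adj G u v ≡ true)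

-- In G + K₁ any two distinct vertices are at distance 1 or 2, so d(e, s) is 0
-- when s is an endpoint of e, 1 when s is adjacent to an endpoint, and 2
-- otherwise.  The edges apex–u and apex–v are therefore told apart only by u
-- and v, so an edge metric generator contains all old vertices but at most one:
-- edim ≥ n − 1.  If moreover u covers V ∖ N(x), the edges apex–u and x–u are
-- told apart only by x and the apex, so a generator avoiding the apex contains
-- every old vertex, and one containing it has at least 1 + (n − 1) elements.
-- Conversely, a vertex that is an endpoint of exactly one of two edges
-- separates them, which makes the n old vertices a generator.  If some x₀ is
-- covered by no other vertex, even the old vertices other than x₀ suffice: the
-- only pair not separated this way is apex–j against the edge j x₀, and a
-- common non-neighbour of j and x₀ is at distance 1 from the former and 2 from
-- the latter.

module Submission where

open import Defs hiding (sym)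
open import Data.Nat using (ℕ; zero; suc; _∸_; _≤_; _<_; _⊓_; z≤n; s≤s; z<s)
open import Data.Nat.Properties
  using (<-cmp; ≤-trans; <-irrefl; <-asym; ⊓-sel; ⊓-zeroʳ; ⊓-comm; n≢0⇒n>0; m≤n⇒m⊓n≡m; m≥n⇒m⊓n≡n;
         m≤n+m∸n; m∸n≤m)
open import Data.Bool using (Bool; true; false; _∧_; _∨_)
open import Data.Bool.Properties using (∨-zeroʳ; ∧-zeroʳ; ∧-identityʳ; T-≡)
import Data.Bool.Properties as Bool
open import Data.Bool.ListAction using (any)
open import Data.Fin using (Fin; zero; suc; toℕ; _≟_)
open import Data.Fin.Properties using (toℕ-injective; suc-injective; toℕ<n; any?; all?; ¬∀⟶∃¬)
open import Data.Fin.Subset using (Subset; _∈_; ∣_∣; inside; outside; ⊤; ∁; ⁅_⁆)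
open import Data.Fin.Subset.Properties
  using (_∈?_; drop-there; ∣⊤∣≡n; ∣p∣≤∣x∷p∣; p⊆q⇒∣p∣≤∣q∣; ∣∁p∣≡n∸∣p∣; ∣⁅x⁆∣≡1;
         x≢y⇒x∉⁅y⁆; x∉⁅y⁆⇒x≢y; x∉p⇒x∈∁p; x∈∁p⇒x∉p)
open import Data.Vec using (_∷_; there)
open import Data.List using ([]; _∷_; allFin)
import Data.List.Relation.Unary.Any as Any
open import Data.List.Relation.Unary.Any.Properties using (any⁺)
open import Data.List.Membership.Propositional.Properties using (∈-allFin)
open import Data.Product using (∃; _×_; _,_; proj₁)
open import Data.Sum using (_⊎_; inj₁; inj₂; [_,_])
import Data.Sum as Sum
open import Data.Empty using (⊥-elim)
open import Function using (_∘_; id)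
open import Function.Bundles using (Equivalence)
open import Relation.Nullary using (⌊_⌋; ¬_; Dec; yes; no; ¬?; contradiction)
open import Relation.Nullary.Decidable using (isYes≗does; dec-true; dec-false; _×-dec_; _⊎-dec_; _→-dec_)
open import Relation.Binary.Definitions using (tri<; tri≈; tri>)
open import Relation.Binary.PropositionalEquality
  using (_≡_; _≢_; refl; sym; trans; cong; cong₂; subst; subst₂; ≢-sym)

⌊⌋-true : ∀ {A : Set} (a? : Dec A) → A → ⌊ a? ⌋ ≡ true
⌊⌋-true a? a = trans (isYes≗does a?) (dec-true a? a)

⌊⌋-false : ∀ {A : Set} (a? : Dec A) → ¬ A → ⌊ a? ⌋ ≡ false
⌊⌋-false a? ¬a = trans (isYes≗does a?) (dec-false a? ¬a)

any-allFin : ∀ {n} (f : Fin n → Bool) w → f w ≡ true → any f (allFin n) ≡ true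
any-allFin f w fw =
  Equivalence.to T-≡ (any⁺ f (Any.map (λ { refl → Equivalence.from T-≡ fw }) (∈-allFin w)))

any-false : ∀ {A : Set} {f : A → Bool} → (∀ x → f x ≡ false) → ∀ xs → any f xs ≡ false
any-false h []       = refl
any-false h (x ∷ xs) rewrite h x = any-false h xs

least-≡ : ∀ b (p : ℕ → Bool) k → k ≤ b → (∀ i → i < k → p i ≡ false) → p k ≡ true →
          least b p ≡ k
least-≡ zero    p zero    _         _     _  = refl
least-≡ (suc b) p zero    _         _     p0 rewrite p0 = refl
least-≡ (suc b) p (suc k) (s≤s k≤b) below pk rewrite below zero z<s =
  cong suc (least-≡ b (p ∘ suc) k k≤b (λ i i<k → below (suc i) (s≤s i<k)) pk)

least-≢0 : ∀ b (p : ℕ → Bool) → 0 < b → p 0 ≡ false → least b p ≢ 0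
least-≢0 (suc b) p _ p0 rewrite p0 = λ ()

index⇒0< : ∀ {n} → Fin n → 0 < n
index⇒0< i = ≤-trans (s≤s z≤n) (toℕ<n i)

Endpoint : ∀ {m} → Fin m → Fin m → Fin m → Set
Endpoint s x y = s ≡ x ⊎ s ≡ y

endpoint? : ∀ {m} (s x y : Fin m) → Dec (Endpoint s x y)
endpoint? s x y = (s ≟ x) ⊎-dec (s ≟ y)

Separates : ∀ {m} → Fin m → Fin m → Fin m → Fin m → Fin m → Set
Separates s x y x' y' = (Endpoint s x y × ¬ Endpoint s x' y') ⊎ (Endpoint s x' y' × ¬ Endpoint s x y)

unshared-endpoint : ∀ {m} {x y x' y' : Fin m} → toℕ x < toℕ y → toℕ x' < toℕ y' →
                    x ≢ x' ⊎ y ≢ y' → ∃ λ s → Endpoint s x y × ¬ Endpoint s x' y'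
unshared-endpoint {x = x} {y} {x'} {y'} x<y x'<y' distinct
  with endpoint? x x' y' | endpoint? y x' y'
... | no x∉ | _     = x , inj₁ refl , x∉
... | yes _ | no y∉ = y , inj₂ refl , y∉
... | yes (inj₁ refl) | yes (inj₁ refl) = ⊥-elim (<-irrefl refl x<y)
... | yes (inj₁ refl) | yes (inj₂ refl) = ⊥-elim ([ (λ f → f refl) , (λ f → f refl) ] distinct)
... | yes (inj₂ refl) | yes (inj₁ refl) = ⊥-elim (<-asym x<y x'<y')
... | yes (inj₂ refl) | yes (inj₂ refl) = ⊥-elim (<-irrefl refl x<y)

-- Both e ∖ e' and e' ∖ e are nonempty, and an element of one differs from any element of the other.
separator : ∀ {m} (z : Fin m) {x y x' y'} → toℕ x < toℕ y → toℕ x' < toℕ y' →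
            x ≢ x' ⊎ y ≢ y' → ∃ λ s → s ≢ z × Separates s x y x' y'
separator z x<y x'<y' distinct
  with unshared-endpoint x<y x'<y' distinct
     | unshared-endpoint x'<y' x<y (Sum.map ≢-sym ≢-sym distinct)
... | s , s∈ , s∉ | t , t∈ , t∉ with s ≟ z
... | no s≢z   = s , s≢z , inj₁ (s∈ , s∉)
... | yes refl = t , (λ { refl → s∉ t∈ }) , inj₂ (t∈ , t∉)

∣∁⁅x⁆∣≡n∸1 : ∀ {n} (x : Fin n) → ∣ ∁ ⁅ x ⁆ ∣ ≡ n ∸ 1
∣∁⁅x⁆∣≡n∸1 {n} x = trans (∣∁p∣≡n∸∣p∣ ⁅ x ⁆) (cong (n ∸_) (∣⁅x⁆∣≡1 x))

full⇒n≤∣p∣ : ∀ {n} {p : Subset n} → (∀ x → x ∈ p) → n ≤ ∣ p ∣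
full⇒n≤∣p∣ {n} {p} all∈ = subst (_≤ ∣ p ∣) (∣⊤∣≡n n) (p⊆q⇒∣p∣≤∣q∣ {p = ⊤} λ {x} _ → all∈ x)

pairCover⇒n∸1≤∣p∣ : ∀ {n} {p : Subset n} → (∀ u v → u ≢ v → u ∈ p ⊎ v ∈ p) → n ∸ 1 ≤ ∣ p ∣
pairCover⇒n∸1≤∣p∣ {n} {p} cover with all? (_∈? p)
... | yes all∈ = ≤-trans (m∸n≤m n 1) (full⇒n≤∣p∣ all∈)
... | no ¬all with ¬∀⟶∃¬ n _ (_∈? p) ¬all
... | x , x∉ = subst (_≤ ∣ p ∣) (∣∁⁅x⁆∣≡n∸1 x) (p⊆q⇒∣p∣≤∣q∣ ∁⁅x⁆⊆p)
  where
  ∁⁅x⁆⊆p : ∀ {v} → v ∈ ∁ ⁅ x ⁆ → v ∈ p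
  ∁⁅x⁆⊆p {v} v∈ = [ id , (λ x∈ → contradiction x∈ x∉) ] (cover v x (x∉⁅y⁆⇒x≢y (x∈∁p⇒x∉p v∈)))

module _ {n} (G : Graph n) where

  reach-step : ∀ {k u w v} → adj G u w ≡ true → reach G k w v ≡ true → reach G (suc k) u v ≡ true
  reach-step {k} {u} {w} {v} uw wv =
    trans (cong (reach G k u v ∨_) (any-allFin _ w (cong₂ _∧_ uw wv))) (∨-zeroʳ _)

  reach-1-nonadj : ∀ {u v} → u ≢ v → adj G u v ≡ false → reach G 1 u v ≡ false
  reach-1-nonadj {u} {v} u≢v uv rewrite ⌊⌋-false (u ≟ v) u≢v = any-false not-via (allFin n)
    where
    not-via : ∀ w → adj G u w ∧ reach G 0 w v ≡ false
    not-via w with w ≟ v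
    ... | yes refl = trans (∧-identityʳ _) uv
    ... | no _     = ∧-zeroʳ _

  adj⇒≢ : ∀ {u v} → adj G u v ≡ true → u ≢ v
  adj⇒≢ {u} uv refl = contradiction (trans (sym uv) (irrefl G u)) λ ()

  edge⊆pair⇒adj : ∀ {i j a b} → toℕ i < toℕ j → adj G i j ≡ true → Endpoint i a b → Endpoint j a b →
                  adj G a b ≡ true
  edge⊆pair⇒adj i<j _  (inj₁ refl) (inj₁ refl) = ⊥-elim (<-irrefl refl i<j)
  edge⊆pair⇒adj _   ij (inj₁ refl) (inj₂ refl) = ij
  edge⊆pair⇒adj {i} {j} _ ij (inj₂ refl) (inj₁ refl) = trans (Graph.sym G j i) ij
  edge⊆pair⇒adj i<j _  (inj₂ refl) (inj₂ refl) = ⊥-elim (<-irrefl refl i<j)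

  dist-refl : ∀ v → dist G v v ≡ 0
  dist-refl v = least-≡ n _ 0 z≤n (λ _ ()) (⌊⌋-true (v ≟ v) refl)

  dist-≢0 : ∀ {u v} → u ≢ v → dist G u v ≢ 0
  dist-≢0 {u} {v} u≢v = least-≢0 n _ (index⇒0< u) (⌊⌋-false (u ≟ v) u≢v)

  dist-adj : ∀ {u v} → adj G u v ≡ true → dist G u v ≡ 1
  dist-adj {u} {v} uv =
    least-≡ n _ 1 (index⇒0< u) below (reach-step {0} {u} {v} {v} uv (⌊⌋-true (v ≟ v) refl))
    where
    below : ∀ i → i < 1 → reach G i u v ≡ false
    below zero _ = ⌊⌋-false (u ≟ v) (adj⇒≢ uv)
    below (suc _) (s≤s ())

  Covers : Fin n → Fin n → Set
  Covers x u = ∀ v → adj G x v ≡ false → adj G u v ≡ true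

  covers? : ∀ x u → Dec (Covers x u)
  covers? x u = all? λ v → (adj G x v Bool.≟ false) →-dec (adj G u v Bool.≟ true)

  ¬Covers⇒common-non-neighbour : ∀ {x u} → ¬ Covers x u →
                                  ∃ λ v → adj G x v ≡ false × adj G u v ≡ false
  ¬Covers⇒common-non-neighbour {x} {u} ¬cov
    with ¬∀⟶∃¬ n _ (λ v → (adj G x v Bool.≟ false) →-dec (adj G u v Bool.≟ true)) ¬cov
  ... | v , ¬imp with adj G x v in xv | adj G u v in uv
  ... | true  | _     = contradiction (λ ()) ¬imp
  ... | false | true  = contradiction (λ _ → refl) ¬imp
  ... | false | false = v , xv , uv

  ¬Cond⇒uncovered : ¬ Cond G → ∃ λ x₀ → ∀ u → u ≢ x₀ → ¬ Covers x₀ u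
  ¬Cond⇒uncovered ¬cond
    with ¬∀⟶∃¬ n _ (λ x → any? λ u → ¬? (u ≟ x) ×-dec covers? x u) ¬cond
  ... | x₀ , none = x₀ , λ u u≢x₀ cov → none (u , u≢x₀ , cov)

  edgeDist-endpoint : ∀ {s x y} → Endpoint s x y → edgeDist G x y s ≡ 0
  edgeDist-endpoint {s} {y = y} (inj₁ refl) = cong (_⊓ dist G y s) (dist-refl s)
  edgeDist-endpoint {s} {x}     (inj₂ refl) = trans (cong (dist G x s ⊓_) (dist-refl s)) (⊓-zeroʳ _)

  edgeDist-≢0 : ∀ {s x y} → ¬ Endpoint s x y → edgeDist G x y s ≢ 0
  edgeDist-≢0 {s} {x} {y} s∉ e with ⊓-sel (dist G x s) (dist G y s)
  ... | inj₁ eq = dist-≢0 (s∉ ∘ inj₁ ∘ sym) (trans (sym eq) e)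
  ... | inj₂ eq = dist-≢0 (s∉ ∘ inj₂ ∘ sym) (trans (sym eq) e)

  edgeDist-≡1 : ∀ {s x y} → ¬ Endpoint s x y → adj G x s ≡ true ⊎ adj G y s ≡ true →
                edgeDist G x y s ≡ 1
  edgeDist-≡1 {s} {x} {y} s∉ (inj₁ xs) rewrite dist-adj xs =
    m≤n⇒m⊓n≡m (n≢0⇒n>0 (dist-≢0 (s∉ ∘ inj₂ ∘ sym)))
  edgeDist-≡1 {s} {x} {y} s∉ (inj₂ ys) rewrite dist-adj ys =
    m≥n⇒m⊓n≡n (n≢0⇒n>0 (dist-≢0 (s∉ ∘ inj₁ ∘ sym)))

  separates⇒edgeDist-≢ : ∀ {s x y x' y'} → Separates s x y x' y' →
                          edgeDist G x y s ≢ edgeDist G x' y' s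
  separates⇒edgeDist-≢ (inj₁ (s∈ , s∉)) e = edgeDist-≢0 s∉ (trans (sym e) (edgeDist-endpoint s∈))
  separates⇒edgeDist-≢ (inj₂ (s∈ , s∉)) e = edgeDist-≢0 s∉ (trans e (edgeDist-endpoint s∈))

  resolves-unordered : ∀ {S x y a b} → EdgeResolving G S → IsEdge G x y → adj G a b ≡ true →
                       ¬ Endpoint x a b → ∃ λ s → s ∈ S × edgeDist G x y s ≢ edgeDist G a b s
  resolves-unordered {x = x} {y} {a} {b} R xy ab x∉ with <-cmp (toℕ a) (toℕ b)
  ... | tri< a<b _ _ = R x y a b xy (a<b , ab) (inj₁ (x∉ ∘ inj₁))
  ... | tri≈ _ a≡b _ = ⊥-elim (adj⇒≢ ab (toℕ-injective a≡b))
  ... | tri> _ _ b<a with R x y b a xy (b<a , trans (Graph.sym G b a) ab) (inj₁ (x∉ ∘ inj₂))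
  ...   | s , s∈ , ≢ = s , s∈ , ≢ ∘ (λ e → trans e (⊓-comm _ _))

  ∁⁅z⁆-resolving : ∀ z → EdgeResolving G (∁ ⁅ z ⁆)
  ∁⁅z⁆-resolving z x y x' y' (x<y , _) (x'<y' , _) distinct with separator z x<y x'<y' distinct
  ... | s , s≢z , sep = s , x∉p⇒x∈∁p (x≢y⇒x∉⁅y⁆ s≢z) , separates⇒edgeDist-≢ sep

module _ {n} (G : Graph n) where

  private
    H : Graph (suc n)
    H = G +K₁

  +K₁-dist-nonadj : ∀ {i j} → i ≢ j → adj G i j ≡ false → dist H (suc i) (suc j) ≡ 2
  +K₁-dist-nonadj {i} {j} i≢j ij =
    least-≡ (suc n) _ 2 (s≤s (index⇒0< i)) below
      (reach-step H {1} {suc i} {zero} {suc j} refl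
        (reach-step H {0} {zero} {suc j} {suc j} refl (⌊⌋-true (suc j ≟ suc j) refl)))
    where
    below : ∀ k → k < 2 → reach H k (suc i) (suc j) ≡ false
    below zero          _ = ⌊⌋-false (suc i ≟ suc j) (i≢j ∘ suc-injective)
    below (suc zero)    _ = reach-1-nonadj H (i≢j ∘ suc-injective) ij
    below (suc (suc _)) (s≤s (s≤s ()))

  apexEdge-edgeDist : ∀ {t w} → w ≢ t → edgeDist H zero (suc t) (suc w) ≡ 1
  apexEdge-edgeDist {t} {w} w≢t =
    edgeDist-≡1 H {suc w} {zero} {suc t} [ (λ ()) , w≢t ∘ suc-injective ] (inj₁ refl)

  resolving⇒pairCover : ∀ {b T} → EdgeResolving H (b ∷ T) → ∀ u v → u ≢ v → u ∈ T ⊎ v ∈ T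
  resolving⇒pairCover R u v u≢v
    with R zero (suc u) zero (suc v) (z<s , refl) (z<s , refl) (inj₂ (u≢v ∘ suc-injective))
  ... | zero , _ , ≢ =
    contradiction (trans (edgeDist-endpoint H {zero} {zero} {suc u} (inj₁ refl))
                         (sym (edgeDist-endpoint H {zero} {zero} {suc v} (inj₁ refl)))) ≢
  ... | suc w , w∈ , ≢ with w ≟ u | w ≟ v
  ... | yes refl | _        = inj₁ (drop-there w∈)
  ... | no _     | yes refl = inj₂ (drop-there w∈)
  ... | no w≢u   | no w≢v   =
    contradiction (trans (apexEdge-edgeDist w≢u) (sym (apexEdge-edgeDist w≢v))) ≢

  covers⇒same-edgeDist : ∀ {x u} → Covers G x u → ∀ {w} → w ≢ x →
                         edgeDist H zero (suc u) (suc w) ≡ edgeDist H (suc x) (suc u) (suc w)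
  covers⇒same-edgeDist {x} {u} covers {w} w≢x with w ≟ u
  ... | yes refl = trans (edgeDist-endpoint H {suc u} {zero} {suc u} (inj₂ refl))
                         (sym (edgeDist-endpoint H {suc u} {suc x} {suc u} (inj₂ refl)))
  ... | no w≢u   = trans (apexEdge-edgeDist w≢u)
                     (sym (edgeDist-≡1 H [ w≢x ∘ suc-injective , w≢u ∘ suc-injective ] neighbour))
    where
    neighbour : adj G x w ≡ true ⊎ adj G u w ≡ true
    neighbour with adj G x w in xw
    ... | true  = inj₁ refl
    ... | false = inj₂ (covers w xw)

  covers⇒separated-only-by : ∀ {x u T s} → Covers G x u → s ∈ outside ∷ T →
                             edgeDist H zero (suc u) s ≢ edgeDist H (suc x) (suc u) s → x ∈ T
  covers⇒separated-only-by {x} {s = suc w} covers w∈ ≢ with w ≟ x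
  ... | yes refl = drop-there w∈
  ... | no w≢x   = contradiction (covers⇒same-edgeDist covers w≢x) ≢

  resolving⇒∈ : Cond G → ∀ {T} → EdgeResolving H (outside ∷ T) → ∀ x → x ∈ T
  resolving⇒∈ cond R x with cond x
  ... | u , _ , covers
    with resolves-unordered H R (z<s , refl) (trans (Graph.sym G x u) (covers x (irrefl G x)))
                            [ (λ ()) , (λ ()) ]
  ... | s , s∈ , ≢ = covers⇒separated-only-by covers s∈ ≢

  module _ (x₀ : Fin n) (uncovered : ∀ u → u ≢ x₀ → ¬ Covers G x₀ u) where

    private
      S : Subset (suc n)
      S = outside ∷ ∁ ⁅ x₀ ⁆

      Resolved : (x y x' y' : Fin (suc n)) → Set
      Resolved x y x' y' = ∃ λ s → s ∈ S × edgeDist H x y s ≢ edgeDist H x' y' s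

      ∈S : ∀ {w} → w ≢ x₀ → suc w ∈ S
      ∈S w≢x₀ = there (x∉p⇒x∈∁p (x≢y⇒x∉⁅y⁆ w≢x₀))

      resolved-sym : ∀ {x y x' y'} → Resolved x y x' y' → Resolved x' y' x y
      resolved-sym (s , s∈ , ≢) = s , s∈ , ≢-sym ≢

    apexEdge-vs-x₀Edge : ∀ {j i' j'} → adj G j x₀ ≡ true → Endpoint i' j x₀ → Endpoint j' j x₀ →
                         Resolved zero (suc j) (suc i') (suc j')
    apexEdge-vs-x₀Edge {j} {i'} {j'} jx₀ i'∈ j'∈
      with ¬Covers⇒common-non-neighbour G (uncovered j (adj⇒≢ G jx₀))
    ... | v , x₀v , jv = suc v , ∈S v≢x₀ , subst₂ _≢_ (sym near) (sym far) λ ()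
      where
      v≢x₀ : v ≢ x₀
      v≢x₀ refl = contradiction (trans (sym jx₀) jv) λ ()
      v≢j : v ≢ j
      v≢j refl = contradiction (trans (sym jx₀) (trans (Graph.sym G v x₀) x₀v)) λ ()
      dist≡2 : ∀ {t} → Endpoint t j x₀ → dist H (suc t) (suc v) ≡ 2
      dist≡2 (inj₁ refl) = +K₁-dist-nonadj (≢-sym v≢j) jv
      dist≡2 (inj₂ refl) = +K₁-dist-nonadj (≢-sym v≢x₀) x₀v
      near : edgeDist H zero (suc j) (suc v) ≡ 1
      near = apexEdge-edgeDist v≢j
      far : edgeDist H (suc i') (suc j') (suc v) ≡ 2
      far = cong₂ _⊓_ (dist≡2 i'∈) (dist≡2 j'∈)

    apexEdge-vs-oldEdge : ∀ j {i' j'} → toℕ i' < toℕ j' → adj G i' j' ≡ true →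
                          Resolved zero (suc j) (suc i') (suc j')
    apexEdge-vs-oldEdge j {i'} {j'} i'<j' i'j' with endpoint? i' j x₀ | endpoint? j' j x₀
    ... | no i'∉ | _ =
      suc i' , ∈S (i'∉ ∘ inj₂) , separates⇒edgeDist-≢ H {suc i'} {zero} {suc j} {suc i'} {suc j'}
                                 (inj₂ (inj₁ refl , [ (λ ()) , i'∉ ∘ inj₁ ∘ suc-injective ]))
    ... | yes _ | no j'∉ =
      suc j' , ∈S (j'∉ ∘ inj₂) , separates⇒edgeDist-≢ H {suc j'} {zero} {suc j} {suc i'} {suc j'}
                                 (inj₂ (inj₂ refl , [ (λ ()) , j'∉ ∘ inj₁ ∘ suc-injective ]))
    ... | yes i'∈ | yes j'∈ = apexEdge-vs-x₀Edge (edge⊆pair⇒adj G i'<j' i'j' i'∈ j'∈) i'∈ j'∈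

    apexEdge-vs-nonApexEdge : ∀ {x y x' y'} → IsEdge H x y → IsEdge H x' y' →
                              Endpoint zero x y → ¬ Endpoint zero x' y' → Resolved x y x' y'
    apexEdge-vs-nonApexEdge {y = zero} (() , _) _ _ _
    apexEdge-vs-nonApexEdge {suc _} {suc _} _ _ apex∈ _ = ⊥-elim ([ (λ ()) , (λ ()) ] apex∈)
    apexEdge-vs-nonApexEdge {x' = zero} _ _ _ apex∉ = ⊥-elim (apex∉ (inj₁ refl))
    apexEdge-vs-nonApexEdge {x' = suc _} {y' = zero} _ (() , _) _ _
    apexEdge-vs-nonApexEdge {zero} {suc j} {suc _} {suc _} _ (s≤s i'<j' , i'j') _ _ =
      apexEdge-vs-oldEdge j i'<j' i'j'

    uncovered⇒resolving : EdgeResolving H S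
    uncovered⇒resolving x y x' y' e e' distinct with separator (suc x₀) (proj₁ e) (proj₁ e') distinct
    ... | suc w , w≢x₀ , sep = suc w , ∈S (w≢x₀ ∘ cong suc) , separates⇒edgeDist-≢ H sep
    ... | zero , _ , inj₁ (apex∈ , apex∉) = apexEdge-vs-nonApexEdge e e' apex∈ apex∉
    ... | zero , _ , inj₂ (apex∈ , apex∉) = resolved-sym (apexEdge-vs-nonApexEdge e' e apex∈ apex∉)

  resolving⇒n∸1≤∣S∣ : ∀ {S} → EdgeResolving H S → n ∸ 1 ≤ ∣ S ∣
  resolving⇒n∸1≤∣S∣ {b ∷ T} R = ≤-trans (pairCover⇒n∸1≤∣p∣ (resolving⇒pairCover R)) (∣p∣≤∣x∷p∣ b T)

  cond⇒resolving⇒n≤∣S∣ : Cond G → ∀ {S} → EdgeResolving H S → n ≤ ∣ S ∣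
  cond⇒resolving⇒n≤∣S∣ _    {inside ∷ T}  R =
    ≤-trans (m≤n+m∸n n 1) (s≤s (pairCover⇒n∸1≤∣p∣ (resolving⇒pairCover R)))
  cond⇒resolving⇒n≤∣S∣ cond {outside ∷ T} R = full⇒n≤∣p∣ (resolving⇒∈ cond R)

theorem4p1 : ∀ (n : ℕ) (G : Graph n) → Connected G →
    (Cond G → IsEdim (G +K₁) n) × (¬ Cond G → IsEdim (G +K₁) (n ∸ 1))
theorem4p1 n G _ = edim-cond , edim-¬cond
  where
  edim-cond : Cond G → IsEdim (G +K₁) n
  edim-cond cond =
    (∁ ⁅ zero ⁆ , ∁⁅z⁆-resolving (G +K₁) zero , ∣∁⁅x⁆∣≡n∸1 zero) , λ _ → cond⇒resolving⇒n≤∣S∣ G cond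

  edim-¬cond : ¬ Cond G → IsEdim (G +K₁) (n ∸ 1)
  edim-¬cond ¬cond with ¬Cond⇒uncovered G ¬cond
  ... | x₀ , uncovered =
    (outside ∷ ∁ ⁅ x₀ ⁆ , uncovered⇒resolving G x₀ uncovered , ∣∁⁅x⁆∣≡n∸1 x₀) , λ _ → resolving⇒n∸1≤∣S∣ G
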